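{- Let $p$ be an odd prime and $v$ an integral vector each of whose entries is nonzero modulo $p$. Let $w$ be a perfect $p$-representative of $v$ and $u$ the shortest $p$-representative of $v$. Then the Hamming distance between $w$ and $u$ is at most $3$. Moreover, for every index $i$ with $w_i\neq u_i$, either (i) $w_i=u_i+p$ and $u_i<0$, or (ii) $w_i=u_i-p$ and $u_i>0$.
   Context: $e$ is the all-one vector. For integral vectors $v,w$: $w$ is a perfect $p$-representative of $v$ if $w\equiv v\pmod p$, $w^{\mathrm T}e=p$ and $w^{\mathrm T}w=p^2$; $w$ is the shortest $p$-representative of $v$ if $w\equiv v\pmod p$ and $|w_i|\le \frac{p-1}{2}$ for every entry $w_i$. The Hamming distance of two vectors is the number of positions in which they differ. -}

module Defs where

open import Data.Nat as ℕ using (ℕ; _∸_; _/_)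
open import Data.Nat.Primality using (Prime)
open import Data.Integer as ℤ using (ℤ; +_; _-_; _*_; _+_; ∣_∣)
open import Data.Integer.Divisibility using (_∣_)
open import Data.Fin using (Fin)
open import Data.Vec using (Vec; lookup; foldr; zipWith; map; []; _∷_)
open import Data.Product using (_×_)
open import Relation.Binary.PropositionalEquality using (_≡_)
open import Relation.Nullary using (¬_; does)
open import Data.Bool using (if_then_else_)
import Data.Integer.Properties as ℤP

_≡_[mod_] : ℤ → ℤ → ℕ → Set
a ≡ b [mod p ] = (+ p) ∣ (a - b)

_≡ᵥ_[mod_] : ∀ {n} → Vec ℤ n → Vec ℤ n → ℕ → Set
w ≡ᵥ v [mod p ] = ∀ i → lookup w i ≡ lookup v i [mod p ]

sumᵥ : ∀ {n} → Vec ℤ n → ℤ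
sumᵥ = foldr _ _+_ (+ 0)

dot : ∀ {n} → Vec ℤ n → Vec ℤ n → ℤ
dot w u = sumᵥ (zipWith _*_ w u)

IsPerfectRep : ℕ → ∀ {n} → Vec ℤ n → Vec ℤ n → Set
IsPerfectRep p v w = (w ≡ᵥ v [mod p ]) × (sumᵥ w ≡ + p) × (dot w w ≡ + (p ℕ.* p))

IsShortestRep : ℕ → ∀ {n} → Vec ℤ n → Vec ℤ n → Set
IsShortestRep p v u = (u ≡ᵥ v [mod p ]) × (∀ i → ∣ lookup u i ∣ ℕ.≤ (p ∸ 1) / 2)

hamming : ∀ {n} → Vec ℤ n → Vec ℤ n → ℕ
hamming [] [] = 0
hamming (x ∷ xs) (y ∷ ys) = (if does (x ℤ.≟ y) then 0 else 1) ℕ.+ hamming xs ys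

{-# OPTIONS --safe #-}
-- If w and u differ in entry i, then w_i − u_i is a nonzero multiple of p while 2|u_i| < p,
-- so 2|w_i| ≥ p + 1. As the squares of the entries of w sum to p², d differing entries give
-- d(p+1)² ≤ 4p² < 4(p+1)², hence d ≤ 3. Moreover w_i² ≤ p², so 0 < |w_i − u_i| < 2p forces
-- w_i − u_i = ±p, and |w_i| ≤ p makes the shift point against the sign of u_i, which is
-- nonzero because v_i ≢ 0 (mod p).
module Submission where

open import Defs
open import Data.Nat using (ℕ; _≤_)
open import Data.Nat.Primality using (Prime)
open import Data.Integer using (ℤ; +_; _+_; _-_; _<_)
open import Data.Fin using (Fin)
open import Data.Vec using (Vec; lookup)
open import Data.Product using (_×_)
open import Data.Sum using (_⊎_)
open import Relation.Binary.PropositionalEquality using (_≡_; _≢_)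
open import Relation.Nullary using (¬_)

import Data.Nat as ℕ
open import Data.Nat using (zero; suc)
import Data.Integer as ℤ
open import Data.Nat.Properties
  using ( ≤-reflexive; ≤-trans; ≤-<-trans; <⇒≱; ≮⇒≥; m≤m+n; m≤n+m; n<1+n; +-identityʳ
        ; +-mono-≤; +-mono-≤-<; +-monoʳ-≤; +-monoʳ-<; +-cancelʳ-<
        ; *-mono-≤; *-mono-<; *-monoˡ-≤; *-monoʳ-<; *-cancelʳ-<; *-distribˡ-+ )
open import Data.Nat.Divisibility using (divides; ∣⇒≤) renaming (_∣_ to _∣ℕ_)
open import Data.Nat.DivMod using (_/_; m/n*n≤m)
open import Data.Nat.Primality using (¬prime[0])
open import Data.Nat.Tactic.RingSolver using (solve-∀)
open import Data.Integer.Properties using (+-injective; ∣i-j∣≡∣j-i∣; ∣i-j∣≤∣i∣+∣j∣; +-minus-telescope; i-j≡0⇒i≡j; ∣i∣≡0⇒i≡0)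
open import Data.Integer.Divisibility using (_∣_)
open import Data.Integer.Divisibility.Signed using (∣ᵤ⇒∣; ∣⇒∣ᵤ; ∣m∣n⇒∣m+n)
open import Data.Integer.Tactic.RingSolver using () renaming (solve-∀ to solve-∀ℤ)
open import Data.Fin using (zero; suc)
open import Data.Vec using ([]; _∷_)
open import Data.Product using (_,_)
open import Data.Sum using (inj₁; inj₂)
open import Data.Empty using (⊥-elim)
open import Function using (_∘_)
open import Relation.Nullary using (yes; no)
open import Relation.Binary.PropositionalEquality using (refl; sym; trans; cong; subst)

∣_∣² : ℤ → ℕ
∣ x ∣² = ℤ.∣ x ∣ ℕ.* ℤ.∣ x ∣

‖_‖² : ∀ {n} → Vec ℤ n → ℕ
‖ [] ‖² = 0
‖ x ∷ xs ‖² = ∣ x ∣² ℕ.+ ‖ xs ‖²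

x*x≡+∣x∣² : ∀ x → x ℤ.* x ≡ + ∣ x ∣²
x*x≡+∣x∣² (+ zero) = refl
x*x≡+∣x∣² (+ suc m) = refl
x*x≡+∣x∣² ℤ.-[1+ m ] = refl

dot-self≡‖‖² : ∀ {n} (w : Vec ℤ n) → dot w w ≡ + ‖ w ‖²
dot-self≡‖‖² [] = refl
dot-self≡‖‖² (x ∷ xs) rewrite x*x≡+∣x∣² x | dot-self≡‖‖² xs = refl

∣lookup∣²≤‖‖² : ∀ {n} (w : Vec ℤ n) i → ∣ lookup w i ∣² ≤ ‖ w ‖²
∣lookup∣²≤‖‖² (x ∷ xs) zero = m≤m+n _ _
∣lookup∣²≤‖‖² (x ∷ xs) (suc i) = ≤-trans (∣lookup∣²≤‖‖² xs i) (m≤n+m _ _)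

hamming*k≤m*‖‖² : ∀ {n} m k (w u : Vec ℤ n)
  → (∀ i → lookup w i ≢ lookup u i → k ≤ m ℕ.* ∣ lookup w i ∣²)
  → hamming w u ℕ.* k ≤ m ℕ.* ‖ w ‖²
hamming*k≤m*‖‖² m k [] [] _ = ℕ.z≤n
hamming*k≤m*‖‖² m k (x ∷ xs) (y ∷ ys) far
  rewrite *-distribˡ-+ m ∣ x ∣² ‖ xs ‖² with x ℤ.≟ y | hamming*k≤m*‖‖² m k xs ys (far ∘ suc)
... | yes _  | ih = ≤-trans ih (m≤n+m _ _)
... | no x≢y | ih = +-mono-≤ (far zero x≢y) ih

≡[mod]-sym : ∀ {p a b} → a ≡ b [mod p ] → b ≡ a [mod p ]
≡[mod]-sym {p} {a} {b} = subst (p ∣ℕ_) (∣i-j∣≡∣j-i∣ a b)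

≡[mod]-trans : ∀ {p a b c} → a ≡ b [mod p ] → b ≡ c [mod p ] → a ≡ c [mod p ]
≡[mod]-trans {p} {a} {b} {c} a≡b b≡c =
  subst (+ p ∣_) (+-minus-telescope a b c) (∣⇒∣ᵤ {+ p} {(a - b) + (b - c)}
    (∣m∣n⇒∣m+n (∣ᵤ⇒∣ {+ p} {a - b} a≡b) (∣ᵤ⇒∣ {+ p} {b - c} b≡c)))

≡[mod]∧≢0[mod]⇒≢0 : ∀ {p a b} → a ≡ b [mod p ] → ¬ (b ≡ + 0 [mod p ]) → a ≢ + 0
≡[mod]∧≢0[mod]⇒≢0 {p} {b = b} a≡b b≢0 refl = b≢0 (≡[mod]-sym {p} {+ 0} {b} a≡b)

≢⇒∣a-b∣≢0 : ∀ {a b} → a ≢ b → ℤ.∣ a - b ∣ ≢ 0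
≢⇒∣a-b∣≢0 {a} {b} a≢b ∣a-b∣≡0 = a≢b (i-j≡0⇒i≡j a b (∣i∣≡0⇒i≡0 ∣a-b∣≡0))

≡[mod]∧≢⇒p≤∣a-b∣ : ∀ {p a b} → a ≡ b [mod p ] → a ≢ b → p ≤ ℤ.∣ a - b ∣
≡[mod]∧≢⇒p≤∣a-b∣ a≡b a≢b = ∣⇒≤ {{ℕ.≢-nonZero (≢⇒∣a-b∣≢0 a≢b)}} a≡b

m∣n∧n≢0∧n<m+m⇒n≡m : ∀ {m n} → m ∣ℕ n → n ≢ 0 → n ℕ.< m ℕ.+ m → n ≡ m
m∣n∧n≢0∧n<m+m⇒n≡m (divides zero refl) n≢0 _ = ⊥-elim (n≢0 refl)
m∣n∧n≢0∧n<m+m⇒n≡m {m} (divides (suc zero) refl) _ _ = +-identityʳ m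
m∣n∧n≢0∧n<m+m⇒n≡m {m} (divides (suc (suc r)) refl) _ n<m+m =
  ⊥-elim (<⇒≱ n<m+m (+-monoʳ-≤ m (m≤m+n m (r ℕ.* m))))

m≤[n∸1]/2⇒m+m<n : ∀ {m n} .{{_ : ℕ.NonZero n}} → m ≤ (n ℕ.∸ 1) / 2 → m ℕ.+ m ℕ.< n
m≤[n∸1]/2⇒m+m<n {m} {suc q} m≤q/2 =
  ℕ.s≤s (subst (_≤ q) (m*2≡m+m m) (≤-trans (*-monoˡ-≤ 2 m≤q/2) (m/n*n≤m q 2)))
  where
  m*2≡m+m : ∀ m → m ℕ.* 2 ≡ m ℕ.+ m
  m*2≡m+m = solve-∀

n≤m+o∧o+o<n⇒n<m+m : ∀ {n} m o → n ≤ m ℕ.+ o → o ℕ.+ o ℕ.< n → n ℕ.< m ℕ.+ m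
n≤m+o∧o+o<n⇒n<m+m {n} m o n≤m+o o+o<n = +-cancelʳ-< n n (m ℕ.+ m) (begin-strict
  n ℕ.+ n                   ≤⟨ +-mono-≤ n≤m+o n≤m+o ⟩
  (m ℕ.+ o) ℕ.+ (m ℕ.+ o)   ≡⟨ regroup m o ⟩
  (m ℕ.+ m) ℕ.+ (o ℕ.+ o)   <⟨ +-monoʳ-< (m ℕ.+ m) o+o<n ⟩
  (m ℕ.+ m) ℕ.+ n           ∎)
  where
  open Data.Nat.Properties.≤-Reasoning
  regroup : ∀ m o → (m ℕ.+ o) ℕ.+ (m ℕ.+ o) ≡ (m ℕ.+ m) ℕ.+ (o ℕ.+ o)
  regroup = solve-∀

m*m≤n*n⇒m≤n : ∀ {m n} → m ℕ.* m ≤ n ℕ.* n → m ≤ n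
m*m≤n*n⇒m≤n m*m≤n*n = ≮⇒≥ (λ n<m → <⇒≱ (*-mono-< n<m n<m) m*m≤n*n)

1+n≤m+m⇒[1+n]²≤4*m² : ∀ {n} m → suc n ≤ m ℕ.+ m → suc n ℕ.* suc n ≤ 4 ℕ.* (m ℕ.* m)
1+n≤m+m⇒[1+n]²≤4*m² {n} m h = subst (suc n ℕ.* suc n ≤_) (double² m) (*-mono-≤ h h)
  where
  double² : ∀ m → (m ℕ.+ m) ℕ.* (m ℕ.+ m) ≡ 4 ℕ.* (m ℕ.* m)
  double² = solve-∀

m*[1+n]²≤4*n²⇒m≤3 : ∀ {m} n → m ℕ.* (suc n ℕ.* suc n) ≤ 4 ℕ.* (n ℕ.* n) → m ≤ 3
m*[1+n]²≤4*n²⇒m≤3 {m} n h = ℕ.s≤s⁻¹ (*-cancelʳ-< (suc n ℕ.* suc n) m 4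
  (≤-<-trans h (*-monoʳ-< 4 (*-mono-< (n<1+n n) (n<1+n n)))))

ShiftedAgainstSign : ℕ → ℤ → ℤ → Set
ShiftedAgainstSign p a b = ((a ≡ b + + p) × (b < + 0)) ⊎ ((a ≡ b - + p) × (+ 0 < b))

shift-by-±p : ∀ {q} b d → ℤ.∣ d ∣ ≡ suc q → ℤ.∣ b + d ∣ ≤ suc q → b ≢ + 0
  → ShiftedAgainstSign (suc q) (b + d) b
shift-by-±p (+ zero)     _              _    _ b≢0 = ⊥-elim (b≢0 refl)
shift-by-±p {q} (+ suc m) (+ _)         refl h _   = ⊥-elim (<⇒≱ (ℕ.s≤s (m≤n+m (suc q) m)) h)
shift-by-±p ℤ.-[1+ m ]   (+ _)          refl _ _   = inj₁ (refl , ℤ.-<+)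
shift-by-±p (+ suc m)    ℤ.-[1+ q ]     refl _ _   = inj₂ (refl , ℤ.+<+ (ℕ.s≤s ℕ.z≤n))
shift-by-±p ℤ.-[1+ m ]   ℤ.-[1+ q ]     refl h _   = ⊥-elim (<⇒≱ (ℕ.s≤s (ℕ.s≤s (m≤n+m q m))) h)

≡[mod]∧≢⇒[1+p]²≤4∣a∣² : ∀ {p a b} → a ≡ b [mod p ] → ℤ.∣ b ∣ ℕ.+ ℤ.∣ b ∣ ℕ.< p → a ≢ b
  → suc p ℕ.* suc p ≤ 4 ℕ.* ∣ a ∣²
≡[mod]∧≢⇒[1+p]²≤4∣a∣² {p} {a} {b} a≡b 2∣b∣<p a≢b = 1+n≤m+m⇒[1+n]²≤4*m² ℤ.∣ a ∣
  (n≤m+o∧o+o<n⇒n<m+m ℤ.∣ a ∣ ℤ.∣ b ∣ p≤∣a∣+∣b∣ 2∣b∣<p)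
  where
  p≤∣a∣+∣b∣ : p ≤ ℤ.∣ a ∣ ℕ.+ ℤ.∣ b ∣
  p≤∣a∣+∣b∣ = ≤-trans (≡[mod]∧≢⇒p≤∣a-b∣ {p} {a} a≡b a≢b) (∣i-j∣≤∣i∣+∣j∣ a b)

≡[mod]∧≢⇒ShiftedAgainstSign : ∀ {q a b} → a ≡ b [mod suc q ] → ℤ.∣ b ∣ ℕ.+ ℤ.∣ b ∣ ℕ.< suc q → ℤ.∣ a ∣ ≤ suc q
  → b ≢ + 0 → a ≢ b → ShiftedAgainstSign (suc q) a b
≡[mod]∧≢⇒ShiftedAgainstSign {q} {a} {b} a≡b 2∣b∣<p ∣a∣≤p b≢0 a≢b =
  subst (λ x → ShiftedAgainstSign (suc q) x b) (b+[a-b]≡a a b)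
    (shift-by-±p b (a - b) ∣a-b∣≡p (subst (λ x → ℤ.∣ x ∣ ≤ suc q) (sym (b+[a-b]≡a a b)) ∣a∣≤p) b≢0)
  where
  b+[a-b]≡a : ∀ a b → b + (a - b) ≡ a
  b+[a-b]≡a = solve-∀ℤ
  ∣a-b∣<p+p : ℤ.∣ a - b ∣ ℕ.< suc q ℕ.+ suc q
  ∣a-b∣<p+p = ≤-<-trans (∣i-j∣≤∣i∣+∣j∣ a b) (+-mono-≤-< ∣a∣≤p (≤-<-trans (m≤m+n _ _) 2∣b∣<p))
  ∣a-b∣≡p : ℤ.∣ a - b ∣ ≡ suc q
  ∣a-b∣≡p = m∣n∧n≢0∧n<m+m⇒n≡m a≡b (≢⇒∣a-b∣≢0 a≢b) ∣a-b∣<p+p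

-- Primality is used only through p ≠ 0.
lemma3p8 : (p : ℕ) → Prime p → p ≢ 2 → (n : ℕ) → (v w u : Vec ℤ n)
    → (∀ i → ¬ (lookup v i ≡ + 0 [mod p ]))
    → IsPerfectRep p v w → IsShortestRep p v u
    → (hamming w u ≤ 3)
      × (∀ i → lookup w i ≢ lookup u i
           → ((lookup w i ≡ lookup u i + + p) × (lookup u i < + 0))
             ⊎ ((lookup w i ≡ lookup u i - + p) × (+ 0 < lookup u i)))
lemma3p8 zero p-prime = ⊥-elim (¬prime[0] p-prime)
lemma3p8 p@(suc _) _ _ n v w u v≢0 (w≡v , _ , w·w≡p²) (u≡v , u-short) = hamming≤3 , shifted
  where
  w≡u : ∀ i → lookup w i ≡ lookup u i [mod p ]
  w≡u i = ≡[mod]-trans {p} {lookup w i} {lookup v i} (w≡v i) (≡[mod]-sym {p} {lookup u i} (u≡v i))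

  2∣u∣<p : ∀ i → ℤ.∣ lookup u i ∣ ℕ.+ ℤ.∣ lookup u i ∣ ℕ.< p
  2∣u∣<p i = m≤[n∸1]/2⇒m+m<n (u-short i)

  ‖w‖²≡p² : ‖ w ‖² ≡ p ℕ.* p
  ‖w‖²≡p² = +-injective (trans (sym (dot-self≡‖‖² w)) w·w≡p²)

  [1+p]²≤4∣w∣² : ∀ i → lookup w i ≢ lookup u i → suc p ℕ.* suc p ≤ 4 ℕ.* ∣ lookup w i ∣²
  [1+p]²≤4∣w∣² i = ≡[mod]∧≢⇒[1+p]²≤4∣a∣² {a = lookup w i} (w≡u i) (2∣u∣<p i)

  hamming≤3 : hamming w u ≤ 3
  hamming≤3 = m*[1+n]²≤4*n²⇒m≤3 p (≤-trans (hamming*k≤m*‖‖² 4 (suc p ℕ.* suc p) w u [1+p]²≤4∣w∣²)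
    (≤-reflexive (cong (4 ℕ.*_) ‖w‖²≡p²)))

  ∣w∣≤p : ∀ i → ℤ.∣ lookup w i ∣ ≤ p
  ∣w∣≤p i = m*m≤n*n⇒m≤n (≤-trans (∣lookup∣²≤‖‖² w i) (≤-reflexive ‖w‖²≡p²))

  shifted : ∀ i → lookup w i ≢ lookup u i → ShiftedAgainstSign p (lookup w i) (lookup u i)
  shifted i = ≡[mod]∧≢⇒ShiftedAgainstSign (w≡u i) (2∣u∣<p i) (∣w∣≤p i) (≡[mod]∧≢0[mod]⇒≢0 {b = lookup v i} (u≡v i) (v≢0 i))
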